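{- Let $q>4$ and $q'\in\{2q+1,2q+2\}$. Choose $x,y,z\in\mathbb{Z}_q$ as follows: if $q'=2q+1$ (and $q\ge5$), $x=2$, $y=q-2$, $z=q-1$; if $q'=2q+2$ and $q\ge 7$, $x=4$, $y=q-2$, $z=q-1$; if $(q,q')=(5,12)$, $(x,y,z)=(0,1,4)$; if $(q,q')=(6,14)$, $(x,y,z)=(0,1,2)$. Let $S$ be an $\mathcal{OS}_q(2)$ of maximal period $m$ (i.e.\ $m=q(q-1)/2$ for $q$ odd, $m=q(q-2)/2$ for $q$ even) whose ring sequence has the form $[x,y,z,x,\ldots]$ if $x=0$, and the form $[0,x,y,z,x,\ldots]$ if $x\neq0$ (so the ring sequence $[s_0,\ldots,s_{m-1}]$ has $s_0=0$). Let $t_i=(-1)^{i+m-1}s'_i$ if $s'_i\neq0$ and $t_i=(-1)^{i+m-1}q$ (in $\mathbb{Z}_{q'}$) if $s'_i=0$, and let $U$ be the sequence over $\mathbb{Z}_{q'}$ with ring sequence $[s'_0,\ldots,s'_{m-1},-s'_0,\ldots,-s'_{m-1},t_0,\ldots,t_{m-1},-t_0,\ldots,-t_{m-1}]$ (which thus begins $x',y',z',x'$ or $0,x',y',z',x'$). Let $U^*$ be obtained from $U$ by deleting the cycle $[x'y'z']$ from its ring sequence, i.e.\ removing the three terms $y',z',x'$ that immediately follow the first occurrence of $x'$. Then $U^*$ is an $\mathcal{SOS}_{q'}(2)$ of period $2q(q-1)-3$ ($q$ odd) or $2q(q-2)-3$ ($q$ even), and $w_{q'}(U^*)$ is coprime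 to $q'$.
   Context: For $x\in\mathbb{Z}_q$, $x'$ denotes the residue class in $\mathbb{Z}_{q'}$ of the unique integer in $\{0,\ldots,q-1\}$ representing $x$. A periodic sequence is described by its ring sequence (one period). Write $\mathbf{s}_n(i)=(s_i,\ldots,s_{i+n-1})$; for an $n$-tuple $\mathbf{u}$, $\mathbf{u}^R$ is its reverse and $-\mathbf{u}$ its entrywise negative. An $n$-window sequence of period $m$ is one where $\mathbf{s}_n(i)=\mathbf{s}_n(j)$ implies $i\equiv j\pmod m$. An $\mathcal{OS}_q(n)$ is an $n$-window sequence over $\mathbb{Z}_q$ with $\mathbf{s}_n(i)\neq\mathbf{s}_n(j)^R$ for all $i,j$; an $\mathcal{SOS}_q(n)$ is an $\mathcal{OS}_q(n)$ with additionally $\mathbf{s}_n(i)\neq-\mathbf{s}_n(j)^R$ for all $i,j$. The weight $w(U)$ of a sequence over $\mathbb{Z}_{q'}$ is the sum of the terms of its ring sequence, each treated as an integer in $[0,q'-1]$; $w_{q'}(U)=w(U)\bmod q'$. -}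

module Defs where

open import Data.Nat using (ℕ; zero; suc; _+_; _*_; _∸_; _/_; _%_; _≤_; NonZero)
open import Data.Nat.DivMod using (_mod_)
open import Data.Fin using (Fin; toℕ; _≟_)
open import Data.List using (List; []; _∷_; length; map; _++_; drop)
open import Data.Nat.ListAction using (sum)
open import Data.Sum using (_⊎_)
import Data.List as List
open import Data.Vec using (Vec; tabulate; reverse)
import Data.Vec as Vec
open import Data.Product using (Σ; ∃; _×_; _,_)
open import Data.Empty using (⊥)
open import Relation.Nullary using (¬_; yes; no)
open import Relation.Binary.PropositionalEquality using (_≡_; _≢_)

CongMod : ℕ → ℕ → ℕ → Set
CongMod m i j = ∃ λ a → ∃ λ b → i + a * m ≡ j + b * m

-- term s_i of the periodic sequence with (nonempty) ring sequence a ∷ as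
at : {A : Set} → A → List A → ℕ → A
at a as i = List.lookup (a ∷ as) (i mod suc (length as))

win : {A : Set} (n : ℕ) → A → List A → ℕ → Vec A n
win n a as i = tabulate λ k → at a as (i + toℕ k)

neg : {q : ℕ} .{{_ : NonZero q}} → Fin q → Fin q
neg {q} x = (q ∸ toℕ x) mod q

red : {q q' : ℕ} .{{_ : NonZero q'}} → Fin q → Fin q'
red {q' = q'} x = toℕ x mod q'

-- n-window sequence whose period is the length of its ring sequence
IsWindowSeq : {A : Set} → ℕ → List A → Set
IsWindowSeq n [] = ⊥
IsWindowSeq n (a ∷ as) =
  ∀ i j → win n a as i ≡ win n a as j → CongMod (length (a ∷ as)) i j

IsOS : {q : ℕ} → ℕ → List (Fin q) → Set
IsOS n [] = ⊥
IsOS n (a ∷ as) = IsWindowSeq n (a ∷ as)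
  × (∀ i j → win n a as i ≢ reverse (win n a as j))

IsSOS : {q : ℕ} .{{_ : NonZero q}} → ℕ → List (Fin q) → Set
IsSOS n [] = ⊥
IsSOS n (a ∷ as) = IsOS n (a ∷ as)
  × (∀ i j → win n a as i ≢ Vec.map neg (reverse (win n a as j)))

maxPer : ℕ → ℕ
maxPer q with q % 2
... | zero = (q * (q ∸ 2)) / 2
... | suc _ = (q * (q ∸ 1)) / 2

perU* : ℕ → ℕ
perU* q with q % 2
... | zero = 2 * q * (q ∸ 2) ∸ 3
... | suc _ = 2 * q * (q ∸ 1) ∸ 3

sgn : {q : ℕ} .{{_ : NonZero q}} → ℕ → Fin q → Fin q
sgn k v with k % 2
... | zero = v
... | suc _ = neg v

tTerm : (q q' : ℕ) .{{_ : NonZero q'}} → ℕ → ℕ → Fin q' → Fin q'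
tTerm q q' i m v with toℕ v
... | zero = sgn (i + m ∸ 1) (q mod q')
... | suc _ = sgn (i + m ∸ 1) v

tList : (q q' : ℕ) .{{_ : NonZero q'}} → ℕ → ℕ → List (Fin q') → List (Fin q')
tList q q' m i [] = []
tList q q' m i (v ∷ vs) = tTerm q q' i m v ∷ tList q q' m (suc i) vs

Useq : (q q' : ℕ) .{{_ : NonZero q'}} → List (Fin q) → List (Fin q')
Useq q q' S =
  let S' = map red S
      T  = tList q q' (length S) 0 S'
  in S' ++ map neg S' ++ T ++ map neg T

delAfter : {q : ℕ} → Fin q → List (Fin q) → List (Fin q)
delAfter x [] = []
delAfter x (a ∷ as) with a ≟ x
... | yes _ = a ∷ drop 3 as
... | no _ = a ∷ delAfter x as

weight : {q : ℕ} → List (Fin q) → ℕ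
weight U = sum (map toℕ U)

Choice : (q q' : ℕ) → Fin q → Fin q → Fin q → Set
Choice q q' x y z =
    (q' ≡ 2 * q + 1 × 5 ≤ q × toℕ x ≡ 2 × toℕ y ≡ q ∸ 2 × toℕ z ≡ q ∸ 1)
  ⊎ (q' ≡ 2 * q + 2 × 7 ≤ q × toℕ x ≡ 4 × toℕ y ≡ q ∸ 2 × toℕ z ≡ q ∸ 1)
  ⊎ (q ≡ 5 × q' ≡ 12 × toℕ x ≡ 0 × toℕ y ≡ 1 × toℕ z ≡ 4)
  ⊎ (q ≡ 6 × q' ≡ 14 × toℕ x ≡ 0 × toℕ y ≡ 1 × toℕ z ≡ 2)

HasForm : {q : ℕ} → Fin q → Fin q → Fin q → List (Fin q) → Set
HasForm x y z S =
    (toℕ x ≡ 0 → ∃ λ r → S ≡ x ∷ y ∷ z ∷ x ∷ r)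
  × (toℕ x ≢ 0 → ∃ λ a → ∃ λ r → toℕ a ≡ 0 × S ≡ a ∷ x ∷ y ∷ z ∷ x ∷ r)

{-# OPTIONS --safe #-}
module Submission where

open import Defs
open import Data.Nat using (ℕ; _+_; _*_; _<_; _%_; NonZero)
open import Data.Nat.Coprimality using (Coprime)
open import Data.Fin using (Fin)
open import Data.List using (List; length)
open import Data.Product using (_×_)
open import Data.Sum using (_⊎_)
open import Relation.Binary.PropositionalEquality using (_≡_)

open import Data.Bool using (Bool; true; false; _∧_)
open import Data.Bool.Properties using (∧-identityʳ)
open import Data.Empty using (⊥)
open import Data.Fin using (toℕ)
import Data.Fin as Fin
open import Data.Fin.Properties using (toℕ-fromℕ<; toℕ-injective; toℕ<n)
open import Data.List using ([]; _∷_; map; _++_)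
import Data.List as List
open import Data.List.Properties using (length-map; length-++; map-++; ++-assoc)
open import Data.List.Relation.Unary.All using (All; []; _∷_)
import Data.List.Relation.Unary.All as All
import Data.List.Relation.Unary.All.Properties as All
open import Data.Maybe using (Maybe; just; nothing)
open import Data.Nat using (zero; suc; _∸_; _≤_; _⊓_; _/_; z≤n; s≤s; z<s; _<?_; _≤?_; >-nonZero; >-nonZero⁻¹)
import Data.Nat as ℕ
open import Data.Nat.Coprimality using (coprime?; 1-coprimeTo; coprime-+)
import Data.Nat.Coprimality as Coprimality
open import Data.Nat.DivMod
open import Data.Nat.Divisibility using (_∣_; divides; _∣0; ∣-reflexive; ∣m∣n⇒∣m+n; m%n≡0⇒n∣m; ∣m⇒∣m*n; ∣n⇒∣m*n)
open import Data.Nat.ListAction using (sum)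
open import Data.Nat.ListAction.Properties using (sum-++)
open import Data.Nat.Properties
open import Algebra.Properties.CommutativeSemigroup +-commutativeSemigroup using (interchange; xy∙z≈xz∙y)
open import Data.Nat.Tactic.RingSolver using (solve-∀)
open import Data.Product using (Σ; _,_; proj₁; proj₂; uncurry)
open import Data.Sign using (Sign; opposite)
import Data.Sign as Sign
open import Data.Sum using (inj₁; inj₂)
open import Data.Vec using (_∷_; [])
import Data.Vec as Vec
open import Data.Vec.Properties using (∷-injectiveˡ; ∷-injectiveʳ)
open import Function using (id; _∘_)
open import Relation.Binary.PropositionalEquality using (_≢_; refl; sym; trans; cong; cong₂; subst; subst₂; module ≡-Reasoning)
open import Relation.Nullary using (yes; no; contradiction)
open import Relation.Nullary.Decidable using (from-yes)

-- Fold ℤ_q′ onto ℤ_q by π v = min(v, q′ − v) mod q. Then π (−v) = π v, and every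
-- entry of each block S′, −S′, T, −T of U projects to the entry sᵢ of S at the same position, so
-- windows of U project to windows of S. Hence no window of U is the reverse or the negated reverse
-- of another, and two equal windows of U lie over the same position of S. They lie in the same
-- block because, reading 1, …, q as positive and q′ − q, …, q′ − 1 as negative (disjoint as
-- q′ > 2q), the signs along S′ and −S′ are constant, those along T and −T alternate and never
-- vanish (tᵢ replaces 0 by ±q), and consecutive entries of S are never both 0; a window passing
-- from one block to the next lies over (s_{m−1}, s₀), where s_{m−1} ≠ 0 = s₀ and t_{m−1} = s′_{m−1}.
-- Deleting y z x after the first x only drops windows, so U* is an SOS of length 4m − 3. Since v
-- and −v add up to 0 or q′, q′ divides w(U) = w(U*) + x + y + z; so w(U*) mod q′ = q′ − (x + y + z),
-- which is 2, 1, 7 or 11 in the four cases of the choice of (x, y, z), coprime to q′.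

private variable
  A B : Set

index : A → List A → ℕ → A
index d []       _       = d
index d (x ∷ xs) zero    = x
index d (x ∷ xs) (suc k) = index d xs k

index-length : ∀ (d : A) xs → index d xs (length xs) ≡ d
index-length d []       = refl
index-length d (x ∷ xs) = index-length d xs

index-++ˡ : ∀ (d : A) xs ys {k} → k < length xs → index d (xs ++ ys) k ≡ index d xs k
index-++ˡ d (x ∷ xs) ys {zero}  _         = refl
index-++ˡ d (x ∷ xs) ys {suc k} (s≤s k<n) = index-++ˡ d xs ys k<n

index-++ʳ : ∀ (d : A) xs ys k → index d (xs ++ ys) (length xs + k) ≡ index d ys k
index-++ʳ d []       ys k = refl
index-++ʳ d (x ∷ xs) ys k = index-++ʳ d xs ys k

index-map : ∀ (f : A → B) d d′ xs {k} → k < length xs → index d′ (map f xs) k ≡ f (index d xs k)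
index-map f d d′ (x ∷ xs) {zero}  _         = refl
index-map f d d′ (x ∷ xs) {suc k} (s≤s k<n) = index-map f d d′ xs k<n

lookup≡index : ∀ (d : A) xs (i : Fin (length xs)) → List.lookup xs i ≡ index d xs (toℕ i)
lookup≡index d (x ∷ xs) Fin.zero    = refl
lookup≡index d (x ∷ xs) (Fin.suc i) = lookup≡index d xs i

[1+m]%n≡[1+m%n]%n : ∀ m n .{{_ : NonZero n}} → suc m % n ≡ suc (m % n) % n
[1+m]%n≡[1+m%n]%n m n = begin
  (1 + m) % n                ≡⟨ %-distribˡ-+ 1 m n ⟩
  (1 % n + m % n) % n        ≡⟨ cong (λ t → (1 % n + t) % n) (m%n%n≡m%n m n) ⟨
  (1 % n + m % n % n) % n    ≡⟨ %-distribˡ-+ 1 (m % n) n ⟨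
  suc (m % n) % n            ∎
  where open ≡-Reasoning

%⇒CongMod : ∀ n .{{_ : NonZero n}} {i j} → i % n ≡ j % n → CongMod n i j
%⇒CongMod n {i} {j} eq = j / n , i / n , (begin
  i + j / n * n                   ≡⟨ cong (_+ j / n * n) (m≡m%n+[m/n]*n i n) ⟩
  i % n + i / n * n + j / n * n   ≡⟨ xy∙z≈xz∙y (i % n) _ _ ⟩
  i % n + j / n * n + i / n * n   ≡⟨ cong (λ t → t + j / n * n + i / n * n) eq ⟩
  j % n + j / n * n + i / n * n   ≡⟨ cong (_+ i / n * n) (m≡m%n+[m/n]*n j n) ⟨
  j + i / n * n                   ∎)
  where open ≡-Reasoning

CongMod⇒≡ : ∀ n .{{_ : NonZero n}} {i j} → i < n → j < n → CongMod n i j → i ≡ j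
CongMod⇒≡ n {i} {j} i<n j<n (a , b , eq) = begin
  i                ≡⟨ m<n⇒m%n≡m i<n ⟨
  i % n            ≡⟨ [m+kn]%n≡m%n i a n ⟨
  (i + a * n) % n  ≡⟨ cong (_% n) eq ⟩
  (j + b * n) % n  ≡⟨ [m+kn]%n≡m%n j b n ⟩
  j % n            ≡⟨ m<n⇒m%n≡m j<n ⟩
  j                ∎
  where open ≡-Reasoning

-- The windows of a sequence of period n are (u k , u (suc k)) for k < n;
-- a function u representing it must satisfy u n ≡ u 0.
WindowsInjective : ℕ → (ℕ → A) → Set
WindowsInjective n u = ∀ {k l} → k < n → l < n → u k ≡ u l → u (suc k) ≡ u (suc l) → k ≡ l

ReverseFree : (A → A) → ℕ → (ℕ → A) → Set
ReverseFree g n u = ∀ {k l} → k < n → l < n → u k ≡ g (u (suc l)) → u (suc k) ≡ g (u l) → ⊥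

-- With g = neg these are the SOS conditions, with g = id the OS conditions.
SOSWindows : (A → A) → ℕ → (ℕ → A) → Set
SOSWindows g n u = WindowsInjective n u × ReverseFree id n u × ReverseFree g n u

module _ (a : A) (as : List A) where
  private
    n = suc (length as)
    s = index a (a ∷ as)

  index-% : ∀ {k} → k ≤ n → s (k % n) ≡ s k
  index-% {k} k≤n with m≤n⇒m<n∨m≡n k≤n
  ... | inj₁ k<n  = cong s (m<n⇒m%n≡m k<n)
  ... | inj₂ refl = trans (cong s (n%n≡0 n)) (sym (index-length a (a ∷ as)))

  at≡index : ∀ j → at a as j ≡ s (j % n)
  at≡index j = trans (lookup≡index a (a ∷ as) (j mod n)) (cong s (toℕ-fromℕ< (m%n<n j n)))

  win₂≡ : ∀ i → win 2 a as i ≡ s (i % n) ∷ s (suc (i % n)) ∷ []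
  win₂≡ i = cong₂ (λ u v → u ∷ v ∷ []) first second
    where
    first : at a as (i + 0) ≡ s (i % n)
    first = trans (at≡index (i + 0)) (cong (λ j → s (j % n)) (+-identityʳ i))
    second : at a as (i + 1) ≡ s (suc (i % n))
    second = begin
      at a as (i + 1)      ≡⟨ at≡index (i + 1) ⟩
      s ((i + 1) % n)      ≡⟨ cong (λ j → s (j % n)) (+-comm i 1) ⟩
      s (suc i % n)        ≡⟨ cong s ([1+m]%n≡[1+m%n]%n i n) ⟩
      s (suc (i % n) % n)  ≡⟨ index-% (m%n<n i n) ⟩
      s (suc (i % n))      ∎
      where open ≡-Reasoning

  win₂-< : ∀ {k} → k < n → win 2 a as k ≡ s k ∷ s (suc k) ∷ []
  win₂-< {k} k<n = trans (win₂≡ k) (cong (λ j → s j ∷ s (suc j) ∷ []) (m<n⇒m%n≡m k<n))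

IsOS⇒SOSWindows : ∀ {q} (a : Fin q) as → IsOS 2 (a ∷ as) → SOSWindows id (length (a ∷ as)) (index a (a ∷ as))
IsOS⇒SOSWindows a as (distinct , no-reverse) = injective , reverse-free , reverse-free
  where
  s = index a (a ∷ as)
  injective : WindowsInjective _ s
  injective {k} {l} k<n l<n e₀ e₁ = CongMod⇒≡ _ k<n l<n (distinct k l (begin
    win 2 a as k            ≡⟨ win₂-< a as k<n ⟩
    s k ∷ s (suc k) ∷ []    ≡⟨ cong₂ (λ u v → u ∷ v ∷ []) e₀ e₁ ⟩
    s l ∷ s (suc l) ∷ []    ≡⟨ win₂-< a as l<n ⟨
    win 2 a as l            ∎))
    where open ≡-Reasoning
  reverse-free : ReverseFree id _ s
  reverse-free {k} {l} k<n l<n e₀ e₁ = no-reverse k l (begin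
    win 2 a as k                  ≡⟨ win₂-< a as k<n ⟩
    s k ∷ s (suc k) ∷ []          ≡⟨ cong₂ (λ u v → u ∷ v ∷ []) e₀ e₁ ⟩
    s (suc l) ∷ s l ∷ []          ≡⟨ cong Vec.reverse (win₂-< a as l<n) ⟨
    Vec.reverse (win 2 a as l)    ∎)
    where open ≡-Reasoning

SOSWindows⇒IsSOS : ∀ {q} .{{_ : NonZero q}} (d : Fin q) L → 0 < length L → index d L 0 ≡ d →
  SOSWindows neg (length L) (index d L) → IsSOS 2 L
SOSWindows⇒IsSOS d (c ∷ cs) _ refl (injective , reverse-free , neg-reverse-free) =
  (distinct , no-reverse) , no-neg-reverse
  where
  n = length (c ∷ cs)
  s = index c (c ∷ cs)
  entries : ∀ {u v u′ v′ : Fin _} → Vec._∷_ u (v ∷ []) ≡ u′ ∷ v′ ∷ [] → u ≡ u′ × v ≡ v′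
  entries e = ∷-injectiveˡ e , ∷-injectiveˡ (∷-injectiveʳ e)
  distinct : ∀ i j → win 2 c cs i ≡ win 2 c cs j → CongMod n i j
  distinct i j e with entries (trans (sym (win₂≡ c cs i)) (trans e (win₂≡ c cs j)))
  ... | e₀ , e₁ = %⇒CongMod n (injective (m%n<n i n) (m%n<n j n) e₀ e₁)
  no-reverse : ∀ i j → win 2 c cs i ≢ Vec.reverse (win 2 c cs j)
  no-reverse i j e
    with entries (trans (sym (win₂≡ c cs i)) (trans e (cong Vec.reverse (win₂≡ c cs j))))
  ... | e₀ , e₁ = reverse-free (m%n<n i n) (m%n<n j n) e₀ e₁
  no-neg-reverse : ∀ i j → win 2 c cs i ≢ Vec.map neg (Vec.reverse (win 2 c cs j))
  no-neg-reverse i j e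
    with entries (trans (sym (win₂≡ c cs i)) (trans e (cong (Vec.map neg ∘ Vec.reverse) (win₂≡ c cs j))))
  ... | e₀ , e₁ = neg-reverse-free (m%n<n i n) (m%n<n j n) e₀ e₁

record WindowMap (π : B → A) (N n : ℕ) (v : ℕ → B) (u : ℕ → A) : Set where
  field
    ψ        : ℕ → ℕ
    ψ-<      : ∀ {k} → k < N → ψ k < n
    π-at     : ∀ {k} → k < N → π (v k) ≡ u (ψ k)
    π-at-suc : ∀ {k} → k < N → π (v (suc k)) ≡ u (suc (ψ k))

module _ {π : B → A} {N n v u} (w : WindowMap π N n v u) where
  open WindowMap w

  ReverseFree-pullback : ∀ {g h} → (∀ b → π (g b) ≡ h (π b)) → ReverseFree h n u → ReverseFree g N v
  ReverseFree-pullback {g} {h} π-g reverse-free k<N l<N e₀ e₁ =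
    reverse-free (ψ-< k<N) (ψ-< l<N) (along (π-at k<N) (π-at-suc l<N) e₀) (along (π-at-suc k<N) (π-at l<N) e₁)
    where
    along : ∀ {b b′ c c′} → π b ≡ c → π b′ ≡ c′ → b ≡ g b′ → c ≡ h c′
    along p p′ e = trans (sym p) (trans (cong π e) (trans (π-g _) (cong h p′)))

  FibresSeparated : Set
  FibresSeparated = ∀ {k l} → k < N → l < N → ψ k ≡ ψ l → v k ≡ v l → v (suc k) ≡ v (suc l) → k ≡ l

  WindowsInjective-pullback : FibresSeparated → WindowsInjective n u → WindowsInjective N v
  WindowsInjective-pullback separated injective k<N l<N e₀ e₁ =
    separated k<N l<N (injective (ψ-< k<N) (ψ-< l<N)
      (trans (sym (π-at k<N)) (trans (cong π e₀) (π-at l<N)))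
      (trans (sym (π-at-suc k<N)) (trans (cong π e₁) (π-at-suc l<N))))
      e₀ e₁

  SOSWindows-pullback : ∀ {g h} → (∀ b → π (g b) ≡ h (π b)) → FibresSeparated →
                        SOSWindows h n u → SOSWindows g N v
  SOSWindows-pullback {g} {h} π-g separated (injective , reverse-free , h-reverse-free) =
    WindowsInjective-pullback separated injective ,
    ReverseFree-pullback {id} {id} (λ _ → refl) reverse-free ,
    ReverseFree-pullback {g} {h} π-g h-reverse-free

module DeleteCycle (d x y z : A) (r : List A) where

  skip : List A → ℕ → ℕ
  skip []      k       = 3 + k
  skip (_ ∷ p) zero    = zero
  skip (_ ∷ p) (suc k) = suc (skip p k)

  skip-< : ∀ p {k} → k < length (p ++ x ∷ r) → skip p k < length (p ++ x ∷ y ∷ z ∷ x ∷ r)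
  skip-< []      k<n             = s≤s (s≤s (s≤s k<n))
  skip-< (_ ∷ p) {zero}  _       = z<s
  skip-< (_ ∷ p) {suc k} (s≤s k<n) = s≤s (skip-< p k<n)

  skip-injective : ∀ p {k l} → skip p k ≡ skip p l → k ≡ l
  skip-injective []      refl = refl
  skip-injective (_ ∷ p) {zero}  {zero}  _ = refl
  skip-injective (_ ∷ p) {suc k} {suc l} e = cong suc (skip-injective p (suc-injective e))

  index-head : ∀ p → index d (p ++ x ∷ r) 0 ≡ index d (p ++ x ∷ y ∷ z ∷ x ∷ r) 0
  index-head []      = refl
  index-head (_ ∷ p) = refl

  index-skip : ∀ p k → index d (p ++ x ∷ r) k ≡ index d (p ++ x ∷ y ∷ z ∷ x ∷ r) (skip p k)
  index-skip []      k       = refl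
  index-skip (_ ∷ p) zero    = refl
  index-skip (_ ∷ p) (suc k) = index-skip p k

  index-suc-skip : ∀ p k → index d (p ++ x ∷ r) (suc k) ≡ index d (p ++ x ∷ y ∷ z ∷ x ∷ r) (suc (skip p k))
  index-suc-skip []      k       = refl
  index-suc-skip (_ ∷ p) zero    = index-head p
  index-suc-skip (_ ∷ p) (suc k) = index-suc-skip p k

  deleteCycle-windowMap : ∀ p → WindowMap id (length (p ++ x ∷ r)) (length (p ++ x ∷ y ∷ z ∷ x ∷ r))
                                 (index d (p ++ x ∷ r)) (index d (p ++ x ∷ y ∷ z ∷ x ∷ r))
  deleteCycle-windowMap p = record
    { ψ        = skip p
    ; ψ-<      = skip-< p
    ; π-at     = λ {k} _ → index-skip p k
    ; π-at-suc = λ {k} _ → index-suc-skip p k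
    }

  SOSWindows-deleteCycle : ∀ {g} p →
    SOSWindows g (length (p ++ x ∷ y ∷ z ∷ x ∷ r)) (index d (p ++ x ∷ y ∷ z ∷ x ∷ r)) →
    SOSWindows g (length (p ++ x ∷ r)) (index d (p ++ x ∷ r))
  SOSWindows-deleteCycle {g} p =
    SOSWindows-pullback (deleteCycle-windowMap p) {g} {g} (λ _ → refl) (λ _ _ e _ _ → skip-injective p e)

  length-deleteCycle : ∀ p → length (p ++ x ∷ y ∷ z ∷ x ∷ r) ≡ 3 + length (p ++ x ∷ r)
  length-deleteCycle []      = refl
  length-deleteCycle (_ ∷ p) = cong suc (length-deleteCycle p)

weight-++ : ∀ {n} (xs ys : List (Fin n)) → weight (xs ++ ys) ≡ weight xs + weight ys
weight-++ xs ys = trans (cong sum (map-++ toℕ xs ys)) (sum-++ (map toℕ xs) (map toℕ ys))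

weight-deleteCycle : ∀ {q} (x y z : Fin q) r p →
  weight (p ++ x ∷ y ∷ z ∷ x ∷ r) ≡ weight (p ++ x ∷ r) + (toℕ x + toℕ y + toℕ z)
weight-deleteCycle x y z r [] = rearrange (toℕ x) (toℕ y) (toℕ z) (weight r)
  where
  rearrange : ∀ a b c w → a + (b + (c + (a + w))) ≡ a + w + (a + b + c)
  rearrange = solve-∀
weight-deleteCycle x y z r (c ∷ p) =
  trans (cong (toℕ c +_) (weight-deleteCycle x y z r p)) (sym (+-assoc (toℕ c) _ _))

delAfter-deleteCycle : ∀ {q} (x y z : Fin q) r p → All (_≢ x) p →
  delAfter x (p ++ x ∷ y ∷ z ∷ x ∷ r) ≡ p ++ x ∷ r
delAfter-deleteCycle x y z r [] [] with x Fin.≟ x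
... | yes _   = refl
... | no x≢x = contradiction refl x≢x
delAfter-deleteCycle x y z r (c ∷ p) (c≢x ∷ p≢x) with c Fin.≟ x
... | yes c≡x = contradiction c≡x c≢x
... | no _    = cong (c ∷_) (delAfter-deleteCycle x y z r p p≢x)

−1^_ : ℕ → Sign
−1^ zero          = Sign.+
−1^ suc zero      = Sign.-
−1^ suc (suc k)   = −1^ k

−1^-suc : ∀ k → −1^ suc k ≡ opposite (−1^ k)
−1^-suc zero          = refl
−1^-suc (suc zero)    = refl
−1^-suc (suc (suc k)) = −1^-suc k

−1^-double : ∀ k → −1^ (k + k) ≡ Sign.+
−1^-double zero    = refl
−1^-double (suc k) = trans (cong (λ j → −1^ suc j) (+-suc k k)) (−1^-double k)

signed : ∀ {n} .{{_ : NonZero n}} → Sign → Fin n → Fin n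
signed Sign.+ v = v
signed Sign.- v = neg v

sgn≡signed : ∀ {n} .{{_ : NonZero n}} k (v : Fin n) → sgn k v ≡ signed (−1^ k) v
sgn≡signed zero          v = refl
sgn≡signed (suc zero)    v = refl
sgn≡signed (suc (suc k)) v = sgn≡signed k v

isZero : ∀ {n} → Fin n → Bool
isZero Fin.zero    = true
isZero (Fin.suc _) = false

toℕ≡0⇒isZero : ∀ {n} {c : Fin n} → toℕ c ≡ 0 → isZero c ≡ true
toℕ≡0⇒isZero {c = Fin.zero} _ = refl

isZero-∧ : ∀ {n} {c c′ : Fin n} → c ≢ c′ → isZero c ∧ isZero c′ ≡ false
isZero-∧ {c = Fin.zero}  {Fin.zero}  c≢c′ = contradiction refl c≢c′
isZero-∧ {c = Fin.zero}  {Fin.suc _} _    = refl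
isZero-∧ {c = Fin.suc _}             _    = refl

isZero⇒toℕ≡0 : ∀ {n} {c : Fin n} → isZero c ≡ true → toℕ c ≡ 0
isZero⇒toℕ≡0 {c = Fin.zero} _ = refl

¬isZero⇒0<toℕ : ∀ {n} {c : Fin n} → isZero c ≡ false → 0 < toℕ c
¬isZero⇒0<toℕ {c = Fin.suc _} _ = z<s

-- U = S′ ++ −S′ ++ T ++ −T
Block : Set
Block = Fin 4

pattern S⁺ = Fin.zero
pattern S⁻ = Fin.suc Fin.zero
pattern T⁺ = Fin.suc (Fin.suc Fin.zero)
pattern T⁻ = Fin.suc (Fin.suc (Fin.suc Fin.zero))

nextBlock : Block → Block
nextBlock S⁺ = S⁻
nextBlock S⁻ = T⁺
nextBlock T⁺ = T⁻
nextBlock T⁻ = S⁺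

blockSign : Block → Sign → Sign
blockSign S⁺ _ = Sign.+
blockSign S⁻ _ = Sign.-
blockSign T⁺ ε = ε
blockSign T⁻ ε = opposite ε

-- the sign of the entry of block b at a position of parity ε where the entry of S is 0 iff z
signature : Block → Sign → Bool → Maybe Sign
signature S⁺ _ true = nothing
signature S⁻ _ true = nothing
signature b  ε _    = just (blockSign b ε)

-- the signs along a window starting at parity ε are constant in S′, −S′ and alternate in T, −T
blockAt : Sign → Maybe Sign → Maybe Sign → Block
blockAt _      (just Sign.+) (just Sign.+) = S⁺
blockAt _      (just Sign.-) (just Sign.-) = S⁻
blockAt Sign.+ (just Sign.+) (just Sign.-) = T⁺
blockAt Sign.- (just Sign.-) (just Sign.+) = T⁺
blockAt _      (just _)      (just _)      = T⁻
blockAt _      (just Sign.+) nothing       = S⁺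
blockAt _      nothing       (just Sign.+) = S⁺
blockAt _      _             _             = S⁻

blockAt-signature : ∀ b ε z₁ z₂ → z₁ ∧ z₂ ≡ false →
  blockAt ε (signature b ε z₁) (signature b (opposite ε) z₂) ≡ b
blockAt-signature S⁺ ε      true  false _ = refl
blockAt-signature S⁺ ε      false true  _ = refl
blockAt-signature S⁺ ε      false false _ = refl
blockAt-signature S⁻ ε      true  false _ = refl
blockAt-signature S⁻ ε      false true  _ = refl
blockAt-signature S⁻ ε      false false _ = refl
blockAt-signature T⁺ Sign.+ _     _     _ = refl
blockAt-signature T⁺ Sign.- _     _     _ = refl
blockAt-signature T⁻ Sign.+ _     _     _ = refl
blockAt-signature T⁻ Sign.- _     _     _ = refl

-- a window from the last entry of a block (nonzero, parity +) to the first of the next (zero)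
blockAtWrap : Maybe Sign → Maybe Sign → Block
blockAtWrap (just Sign.+) nothing  = S⁺
blockAtWrap (just Sign.+) (just _) = T⁺
blockAtWrap (just Sign.-) (just _) = S⁻
blockAtWrap _             _        = T⁻

blockAtWrap-signature : ∀ b ε → blockAtWrap (signature b Sign.+ false) (signature (nextBlock b) ε true) ≡ b
blockAtWrap-signature S⁺ _ = refl
blockAtWrap-signature S⁻ _ = refl
blockAtWrap-signature T⁺ _ = refl
blockAtWrap-signature T⁻ _ = refl

module Folding (q q′ : ℕ) .{{_ : NonZero q}} .{{_ : NonZero q′}} (2q<q′ : q + q < q′) where

  q<q′ : q < q′
  q<q′ = ≤-<-trans (m≤m+n q q) 2q<q′

  q<q′∸q : q < q′ ∸ q
  q<q′∸q = subst (_< q′ ∸ q) (m+n∸n≡m q q) (∸-monoˡ-< 2q<q′ (m≤n+m q q))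

  q<q′∸ : ∀ {n} → n ≤ q → q < q′ ∸ n
  q<q′∸ n≤q = <-≤-trans q<q′∸q (∸-monoʳ-≤ q′ n≤q)

  mod-cong : ∀ {m n} → m % q ≡ n % q → m mod q ≡ n mod q
  mod-cong {m} {n} e = toℕ-injective (trans (toℕ-fromℕ< (m%n<n m q)) (trans e (sym (toℕ-fromℕ< (m%n<n n q)))))

  toℕ-red : (c : Fin q) → toℕ (red {q' = q′} c) ≡ toℕ c
  toℕ-red c = trans (toℕ-fromℕ< (m%n<n (toℕ c) q′)) (m<n⇒m%n≡m (<-trans (toℕ<n c) q<q′))

  red-injective : ∀ {c c′ : Fin q} → red {q' = q′} c ≡ red c′ → c ≡ c′
  red-injective {c} {c′} e = toℕ-injective (trans (sym (toℕ-red c)) (trans (cong toℕ e) (toℕ-red c′)))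

  red≤q : (c : Fin q) → toℕ (red {q' = q′} c) ≤ q
  red≤q c = subst (_≤ q) (sym (toℕ-red c)) (<⇒≤ (toℕ<n c))

  negℕ : ℕ → ℕ
  negℕ n = (q′ ∸ n) % q′

  toℕ-neg : (v : Fin q′) → toℕ (neg v) ≡ negℕ (toℕ v)
  toℕ-neg v = toℕ-fromℕ< (m%n<n (q′ ∸ toℕ v) q′)

  negℕ-0 : negℕ 0 ≡ 0
  negℕ-0 = n%n≡0 q′

  negℕ-pos : ∀ {n} → 0 < n → n < q′ → negℕ n ≡ q′ ∸ n
  negℕ-pos 0<n n<q′ = m<n⇒m%n≡m (∸-monoʳ-< 0<n (<⇒≤ n<q′))

  neg-involutive : (v : Fin q′) → neg (neg v) ≡ v
  neg-involutive v = toℕ-injective (trans (toℕ-neg (neg v)) (trans (cong negℕ (toℕ-neg v)) (negℕ-involutive (toℕ<n v))))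
    where
    negℕ-involutive : ∀ {n} → n < q′ → negℕ (negℕ n) ≡ n
    negℕ-involutive {zero}  _      = trans (cong negℕ negℕ-0) negℕ-0
    negℕ-involutive {suc n} n<q′ = begin
      negℕ (negℕ (suc n))       ≡⟨ cong negℕ (negℕ-pos z<s n<q′) ⟩
      negℕ (q′ ∸ suc n)         ≡⟨ negℕ-pos (m<n⇒0<n∸m n<q′) (∸-monoʳ-< z<s (<⇒≤ n<q′)) ⟩
      q′ ∸ (q′ ∸ suc n)         ≡⟨ m∸[m∸n]≡n (<⇒≤ n<q′) ⟩
      suc n                     ∎
      where open ≡-Reasoning

  neg-signed : ∀ ε v → neg (signed ε v) ≡ signed (opposite ε) v
  neg-signed Sign.+ v = refl
  neg-signed Sign.- v = neg-involutive v

  ∣-pair : ∀ v → q′ ∣ toℕ v + toℕ (neg v)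
  ∣-pair v = subst (λ n → q′ ∣ toℕ v + n) (sym (toℕ-neg v)) (∣n+negℕn (toℕ<n v))
    where
    ∣n+negℕn : ∀ {n} → n < q′ → q′ ∣ n + negℕ n
    ∣n+negℕn {zero}  _    = subst (q′ ∣_) (sym negℕ-0) (q′ ∣0)
    ∣n+negℕn {suc n} n<q′ = ∣-reflexive (sym (trans (cong (suc n +_) (negℕ-pos z<s n<q′)) (m+[n∸m]≡n (<⇒≤ n<q′))))

  ∣weight-neg : ∀ L → q′ ∣ weight L + weight (map neg L)
  ∣weight-neg []      = q′ ∣0
  ∣weight-neg (v ∷ L) = subst (q′ ∣_) (interchange (toℕ v) (toℕ (neg v)) (weight L) (weight (map neg L)))
                          (∣m∣n⇒∣m+n (∣-pair v) (∣weight-neg L))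

  ∣_∣ : ℕ → ℕ
  ∣ n ∣ = n ⊓ (q′ ∸ n)

  ∣negℕ∣ : ∀ {n} → n < q′ → ∣ negℕ n ∣ ≡ ∣ n ∣
  ∣negℕ∣ {zero}  _    = cong ∣_∣ negℕ-0
  ∣negℕ∣ {suc n} n<q′ = begin
    ∣ negℕ (suc n) ∣                       ≡⟨ cong ∣_∣ (negℕ-pos z<s n<q′) ⟩
    (q′ ∸ suc n) ⊓ (q′ ∸ (q′ ∸ suc n))     ≡⟨ cong ((q′ ∸ suc n) ⊓_) (m∸[m∸n]≡n (<⇒≤ n<q′)) ⟩
    (q′ ∸ suc n) ⊓ suc n                   ≡⟨ ⊓-comm _ _ ⟩
    ∣ suc n ∣                              ∎
    where open ≡-Reasoning

  ∣small∣ : ∀ {n} → n ≤ q → ∣ n ∣ ≡ n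
  ∣small∣ n≤q = m≤n⇒m⊓n≡m (≤-trans n≤q (<⇒≤ (q<q′∸ n≤q)))

  π : Fin q′ → Fin q
  π v = ∣ toℕ v ∣ mod q

  π-neg : ∀ v → π (neg v) ≡ π v
  π-neg v = cong (_mod q) (trans (cong ∣_∣ (toℕ-neg v)) (∣negℕ∣ (toℕ<n v)))

  π-signed : ∀ ε v → π (signed ε v) ≡ π v
  π-signed Sign.+ v = refl
  π-signed Sign.- v = π-neg v

  π-red : ∀ c → π (red c) ≡ c
  π-red c = toℕ-injective (begin
    toℕ (∣ toℕ (red c) ∣ mod q)  ≡⟨ toℕ-fromℕ< (m%n<n _ q) ⟩
    ∣ toℕ (red c) ∣ % q          ≡⟨ cong (_% q) (∣small∣ (red≤q c)) ⟩
    toℕ (red c) % q              ≡⟨ cong (_% q) (toℕ-red c) ⟩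
    toℕ c % q                    ≡⟨ m<n⇒m%n≡m (toℕ<n c) ⟩
    toℕ c                        ∎)
    where open ≡-Reasoning

  replaceZero : Fin q′ → Fin q′
  replaceZero v with toℕ v
  ... | zero  = q mod q′
  ... | suc _ = v

  tTerm≡signed : ∀ i m v → tTerm q q′ i m v ≡ signed (−1^ (i + m ∸ 1)) (replaceZero v)
  tTerm≡signed i m v with toℕ v
  ... | zero  = sgn≡signed (i + m ∸ 1) (q mod q′)
  ... | suc _ = sgn≡signed (i + m ∸ 1) v

  toℕ-q : toℕ (q mod q′) ≡ q
  toℕ-q = trans (toℕ-fromℕ< (m%n<n q q′)) (m<n⇒m%n≡m q<q′)

  π-replaceZero : ∀ v → π (replaceZero v) ≡ π v
  π-replaceZero v with toℕ v in eq
  ... | zero  = mod-cong (begin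
    ∣ toℕ (q mod q′) ∣ % q   ≡⟨ cong (λ n → ∣ n ∣ % q) toℕ-q ⟩
    ∣ q ∣ % q                ≡⟨ cong (_% q) (∣small∣ ≤-refl) ⟩
    q % q                    ≡⟨ n%n≡0 q ⟩
    0                        ≡⟨ m<n⇒m%n≡m (>-nonZero⁻¹ q) ⟨
    0 % q                    ∎)
    where open ≡-Reasoning
  ... | suc _ = cong (λ n → ∣ n ∣ mod q) eq

  replaceZero-bounds : ∀ v → toℕ v ≤ q → 0 < toℕ (replaceZero v) × toℕ (replaceZero v) ≤ q
  replaceZero-bounds v v≤q with toℕ v in eq
  ... | zero  = subst (0 <_) (sym toℕ-q) (>-nonZero⁻¹ q) , ≤-reflexive toℕ-q
  ... | suc _ = subst (0 <_) (sym eq) z<s , subst (_≤ q) (sym eq) v≤q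

  -- 1, …, q count as positive and q′ − q, …, q′ − 1 as negative
  sideℕ : ℕ → Maybe Sign
  sideℕ zero    = nothing
  sideℕ (suc n) with suc n ≤? q
  ... | yes _ = just Sign.+
  ... | no _  = just Sign.-

  side : Fin q′ → Maybe Sign
  side v = sideℕ (toℕ v)

  side-signed : ∀ ε v → 0 < toℕ v → toℕ v ≤ q → side (signed ε v) ≡ just ε
  side-signed Sign.+ v 0<v v≤q = positive 0<v v≤q
    where
    positive : ∀ {n} → 0 < n → n ≤ q → sideℕ n ≡ just Sign.+
    positive {suc n} _ n≤q with suc n ≤? q
    ... | yes _   = refl
    ... | no n≰q = contradiction n≤q n≰q
  side-signed Sign.- v 0<v v≤q =
    trans (cong sideℕ (trans (toℕ-neg v) (negℕ-pos 0<v (≤-<-trans v≤q q<q′)))) (negative (q<q′∸ v≤q))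
    where
    negative : ∀ {n} → q < n → sideℕ n ≡ just Sign.-
    negative {suc n} q<n with suc n ≤? q
    ... | yes n≤q = contradiction n≤q (<⇒≱ q<n)
    ... | no _    = refl

  side-signed-zero : ∀ ε v → toℕ v ≡ 0 → side (signed ε v) ≡ nothing
  side-signed-zero Sign.+ v v≡0 = cong sideℕ v≡0
  side-signed-zero Sign.- v v≡0 = cong sideℕ (trans (toℕ-neg v) (trans (cong negℕ v≡0) negℕ-0))

  magnitude : Block → Fin q → Fin q′
  magnitude S⁺ c = red c
  magnitude S⁻ c = red c
  magnitude T⁺ c = replaceZero (red c)
  magnitude T⁻ c = replaceZero (red c)

  lift : Block → Sign → Fin q → Fin q′
  lift b ε c = signed (blockSign b ε) (magnitude b c)

  π-lift : ∀ b ε c → π (lift b ε c) ≡ c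
  π-lift b ε c = trans (π-signed (blockSign b ε) (magnitude b c)) (π-magnitude b)
    where
    π-magnitude : ∀ b → π (magnitude b c) ≡ c
    π-magnitude S⁺ = π-red c
    π-magnitude S⁻ = π-red c
    π-magnitude T⁺ = trans (π-replaceZero (red c)) (π-red c)
    π-magnitude T⁻ = trans (π-replaceZero (red c)) (π-red c)

  side-red : ∀ σ c → isZero c ≡ false → side (signed σ (red c)) ≡ just σ
  side-red σ c z = side-signed σ (red c) (subst (0 <_) (sym (toℕ-red c)) (¬isZero⇒0<toℕ z)) (red≤q c)

  side-red-zero : ∀ σ c → isZero c ≡ true → side (signed σ (red c)) ≡ nothing
  side-red-zero σ c z = side-signed-zero σ (red c) (trans (toℕ-red c) (isZero⇒toℕ≡0 z))

  side-lift : ∀ b ε c → side (lift b ε c) ≡ signature b ε (isZero c)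
  side-lift S⁺ ε c with isZero c in z
  ... | true  = side-red-zero Sign.+ c z
  ... | false = side-red Sign.+ c z
  side-lift S⁻ ε c with isZero c in z
  ... | true  = side-red-zero Sign.- c z
  ... | false = side-red Sign.- c z
  side-lift T⁺ ε c = uncurry (side-signed ε _) (replaceZero-bounds (red c) (red≤q c))
  side-lift T⁻ ε c = uncurry (side-signed (opposite ε) _) (replaceZero-bounds (red c) (red≤q c))

module Construction (q q′ : ℕ) .{{_ : NonZero q}} .{{_ : NonZero q′}} (2q<q′ : q + q < q′)
                    (a : Fin q) (as : List (Fin q)) (a≡0 : toℕ a ≡ 0)
                    (S-windows : SOSWindows id (length (a ∷ as)) (index a (a ∷ as))) where
  open Folding q q′ 2q<q′

  S : List (Fin q)
  S = a ∷ as

  m : ℕ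
  m = length S

  s : ℕ → Fin q
  s = index a S

  -- the sign (−1)^(i+m−1) of tᵢ
  ε : ℕ → Sign
  ε i = −1^ (i + length as)

  S′ T : List (Fin q′)
  S′ = map red S
  T  = tList q q′ m 0 S′

  U : List (Fin q′)
  U = Useq q q′ S

  d : Fin q′
  d = red a

  u : ℕ → Fin q′
  u = index d U

  pos : ∀ {n} → Fin n → ℕ → ℕ
  pos Fin.zero    i = i
  pos (Fin.suc b) i = m + pos b i

  length-S′ : length S′ ≡ m
  length-S′ = length-map red S

  length-T : length T ≡ m
  length-T = trans (length-tList 0 S′) length-S′
    where
    length-tList : ∀ j L → length (tList q q′ m j L) ≡ length L
    length-tList j []      = refl
    length-tList j (v ∷ L) = cong suc (length-tList (suc j) L)

  length-neg-S′ : length (map neg S′) ≡ m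
  length-neg-S′ = trans (length-map neg S′) length-S′

  length-U : length U ≡ m + (m + (m + m))
  length-U = ++-length S′ length-S′ (++-length (map neg S′) length-neg-S′
               (++-length T length-T (trans (length-map neg T) length-T)))
    where
    ++-length : ∀ xs {ys : List (Fin q′)} {k l} → length xs ≡ k → length ys ≡ l → length (xs ++ ys) ≡ k + l
    ++-length xs e e′ = trans (length-++ xs) (cong₂ _+_ e e′)

  index-block : ∀ xs ys k → length xs ≡ m → index d (xs ++ ys) (m + k) ≡ index d ys k
  index-block xs ys k e = subst (λ n → index d (xs ++ ys) (n + k) ≡ index d ys k) e (index-++ʳ d xs ys k)

  index-tList : ∀ j L {i} → i < length L → index d (tList q q′ m j L) i ≡ tTerm q q′ (j + i) m (index d L i)
  index-tList j (v ∷ L) {zero}  _         = cong (λ t → tTerm q q′ t m v) (sym (+-identityʳ j))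
  index-tList j (v ∷ L) {suc i} (s≤s i<n) =
    trans (index-tList (suc j) L i<n) (cong (λ t → tTerm q q′ t m (index d L i)) (sym (+-suc j i)))

  S′-entry : ∀ {i} → i < m → index d S′ i ≡ red (s i)
  S′-entry = index-map red a d S

  T-entry : ∀ {i} → i < m → index d T i ≡ signed (ε i) (replaceZero (red (s i)))
  T-entry {i} i<m = begin
    index d T i                             ≡⟨ index-tList 0 S′ (subst (i <_) (sym length-S′) i<m) ⟩
    tTerm q q′ i m (index d S′ i)           ≡⟨ tTerm≡signed i m (index d S′ i) ⟩
    signed (−1^ (i + m ∸ 1)) (replaceZero (index d S′ i))
                                            ≡⟨ cong₂ signed (cong (λ n → −1^ (n ∸ 1)) (+-suc i (length as)))
                                                            (cong replaceZero (S′-entry i<m)) ⟩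
    signed (ε i) (replaceZero (red (s i)))  ∎
    where open ≡-Reasoning

  u-pos : ∀ b {i} → i < m → u (pos b i) ≡ lift b (ε i) (s i)
  u-pos S⁺ {i} i<m = trans (index-++ˡ d S′ _ (subst (i <_) (sym length-S′) i<m)) (S′-entry i<m)
  u-pos S⁻ {i} i<m = begin
    index d (S′ ++ map neg S′ ++ _) (m + i)  ≡⟨ index-block S′ _ i length-S′ ⟩
    index d (map neg S′ ++ _) i              ≡⟨ index-++ˡ d (map neg S′) _ (subst (i <_) (sym length-neg-S′) i<m) ⟩
    index d (map neg S′) i                   ≡⟨ index-map neg d d S′ (subst (i <_) (sym length-S′) i<m) ⟩
    neg (index d S′ i)                       ≡⟨ cong neg (S′-entry i<m) ⟩
    neg (red (s i))                          ∎
    where open ≡-Reasoning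
  u-pos T⁺ {i} i<m = begin
    index d (S′ ++ map neg S′ ++ T ++ _) (m + (m + i))  ≡⟨ index-block S′ _ (m + i) length-S′ ⟩
    index d (map neg S′ ++ T ++ _) (m + i)              ≡⟨ index-block (map neg S′) _ i length-neg-S′ ⟩
    index d (T ++ _) i                                  ≡⟨ index-++ˡ d T _ (subst (i <_) (sym length-T) i<m) ⟩
    index d T i                                         ≡⟨ T-entry i<m ⟩
    signed (ε i) (replaceZero (red (s i)))              ∎
    where open ≡-Reasoning
  u-pos T⁻ {i} i<m = begin
    index d (S′ ++ map neg S′ ++ T ++ map neg T) (m + (m + (m + i)))  ≡⟨ index-block S′ _ (m + (m + i)) length-S′ ⟩
    index d (map neg S′ ++ T ++ map neg T) (m + (m + i))              ≡⟨ index-block (map neg S′) _ (m + i) length-neg-S′ ⟩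
    index d (T ++ map neg T) (m + i)                                  ≡⟨ index-block T _ i length-T ⟩
    index d (map neg T) i                                             ≡⟨ index-map neg d d T (subst (i <_) (sym length-T) i<m) ⟩
    neg (index d T i)                                                 ≡⟨ cong neg (T-entry i<m) ⟩
    neg (signed (ε i) (replaceZero (red (s i))))                      ≡⟨ neg-signed (ε i) _ ⟩
    signed (opposite (ε i)) (replaceZero (red (s i)))                 ∎
    where open ≡-Reasoning

  π-u : ∀ b {i} → i < m → π (u (pos b i)) ≡ s i
  π-u b {i} i<m = trans (cong π (u-pos b i<m)) (π-lift b (ε i) (s i))

  side-u : ∀ b {i} → i < m → side (u (pos b i)) ≡ signature b (ε i) (isZero (s i))
  side-u b {i} i<m = trans (cong side (u-pos b i<m)) (side-lift b (ε i) (s i))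

  ε-suc : ∀ i → ε (suc i) ≡ opposite (ε i)
  ε-suc i = −1^-suc (i + length as)

  ε-last : ε (length as) ≡ Sign.+
  ε-last = −1^-double (length as)

  pos-suc : ∀ {n} (b : Fin n) i → suc (pos b i) ≡ pos b (suc i)
  pos-suc Fin.zero    i = refl
  pos-suc (Fin.suc b) i = trans (sym (+-suc m (pos b i))) (cong (m +_) (pos-suc b i))

  u-wrap : ∀ b → u (pos b m) ≡ u (pos (nextBlock b) 0)
  u-wrap S⁺ = cong u (sym (+-identityʳ m))
  u-wrap S⁻ = cong (λ n → u (m + n)) (sym (+-identityʳ m))
  u-wrap T⁺ = cong (λ n → u (m + (m + n))) (sym (+-identityʳ m))
  u-wrap T⁻ = trans (cong u (sym length-U)) (index-length d U)

  π-u-suc : ∀ b {i} → i < m → π (u (suc (pos b i))) ≡ s (suc i)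
  π-u-suc b {i} i<m with m≤n⇒m<n∨m≡n i<m
  ... | inj₁ 1+i<m = trans (cong (π ∘ u) (pos-suc b i)) (π-u b 1+i<m)
  ... | inj₂ refl  = begin
    π (u (suc (pos b i)))        ≡⟨ cong (π ∘ u) (pos-suc b i) ⟩
    π (u (pos b m))              ≡⟨ cong π (u-wrap b) ⟩
    π (u (pos (nextBlock b) 0))  ≡⟨ π-u (nextBlock b) z<s ⟩
    a                            ≡⟨ index-length a S ⟨
    s m                          ∎
    where open ≡-Reasoning

  -- a window (c , c) would be its own reverse
  consecutive-distinct : ∀ {i} → i < m → s i ≢ s (suc i)
  consecutive-distinct i<m e = proj₁ (proj₂ S-windows) i<m i<m e (sym e)

  isZero-s-last : isZero (s (length as)) ≡ false
  isZero-s-last = trans (sym (∧-identityʳ _))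
    (subst (λ z → isZero (s (length as)) ∧ z ≡ false) isZero-s-m (isZero-∧ (consecutive-distinct ≤-refl)))
    where
    isZero-s-m : isZero (s m) ≡ true
    isZero-s-m = trans (cong isZero (index-length a S)) (toℕ≡0⇒isZero a≡0)

  signature-≡ : ∀ b b′ {i} → i < m → u (pos b i) ≡ u (pos b′ i) →
    signature b (ε i) (isZero (s i)) ≡ signature b′ (ε i) (isZero (s i))
  signature-≡ b b′ i<m e = trans (sym (side-u b i<m)) (trans (cong side e) (side-u b′ i<m))

  blocks-separated : ∀ b b′ {i} → i < m →
    u (pos b i) ≡ u (pos b′ i) → u (suc (pos b i)) ≡ u (suc (pos b′ i)) → b ≡ b′
  blocks-separated b b′ {i} i<m e₀ e₁ with m≤n⇒m<n∨m≡n i<m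
  ... | inj₁ 1+i<m = begin
    b                                                   ≡⟨ blockAt-signature b (ε i) _ _ nonzero ⟨
    blockAt (ε i) (signature b (ε i) _) (signature b (opposite (ε i)) _)
                                                        ≡⟨ cong₂ (blockAt (ε i)) (signature-≡ b b′ i<m e₀) next ⟩
    blockAt (ε i) (signature b′ (ε i) _) (signature b′ (opposite (ε i)) _)
                                                        ≡⟨ blockAt-signature b′ (ε i) _ _ nonzero ⟩
    b′                                                  ∎
    where
    open ≡-Reasoning
    nonzero : isZero (s i) ∧ isZero (s (suc i)) ≡ false
    nonzero = isZero-∧ (consecutive-distinct i<m)
    z = isZero (s (suc i))
    next : signature b (opposite (ε i)) z ≡ signature b′ (opposite (ε i)) z
    next = subst (λ σ → signature b σ z ≡ signature b′ σ z) (ε-suc i)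
             (signature-≡ b b′ 1+i<m (subst₂ (λ k l → u k ≡ u l) (pos-suc b i) (pos-suc b′ i) e₁))
  ... | inj₂ refl = begin
    b                                                   ≡⟨ blockAtWrap-signature b (ε 0) ⟨
    blockAtWrap (signature b Sign.+ false) (signature (nextBlock b) (ε 0) true)
                                                        ≡⟨ cong₂ blockAtWrap last first ⟩
    blockAtWrap (signature b′ Sign.+ false) (signature (nextBlock b′) (ε 0) true)
                                                        ≡⟨ blockAtWrap-signature b′ (ε 0) ⟩
    b′                                                  ∎
    where
    open ≡-Reasoning
    last : signature b Sign.+ false ≡ signature b′ Sign.+ false
    last = subst₂ (λ σ z → signature b σ z ≡ signature b′ σ z) ε-last isZero-s-last (signature-≡ b b′ i<m e₀)
    e₁′ : u (pos (nextBlock b) 0) ≡ u (pos (nextBlock b′) 0)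
    e₁′ = trans (sym (u-wrap b)) (trans (subst₂ (λ k l → u k ≡ u l) (pos-suc b i) (pos-suc b′ i) e₁) (u-wrap b′))
    first : signature (nextBlock b) (ε 0) true ≡ signature (nextBlock b′) (ε 0) true
    first = subst (λ z → signature (nextBlock b) (ε 0) z ≡ signature (nextBlock b′) (ε 0) z) (toℕ≡0⇒isZero a≡0)
              (signature-≡ (nextBlock b) (nextBlock b′) z<s e₁′)

  decompose : ∀ {n} k → k < n * m → Σ (Fin n) λ b → Σ ℕ λ i → i < m × pos b i ≡ k
  decompose {suc n} k k<N with k <? m
  ... | yes k<m = Fin.zero , k , k<m , refl
  ... | no k≮m =
    let b , i , i<m , e = decompose {n} (k ∸ m) (+-cancelˡ-< m _ _ (subst (_< m + n * m) (sym m+[k∸m]≡k) k<N))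
    in  Fin.suc b , i , i<m , trans (cong (m +_) e) m+[k∸m]≡k
    where
    m+[k∸m]≡k : m + (k ∸ m) ≡ k
    m+[k∸m]≡k = m+[n∸m]≡n (≮⇒≥ k≮m)

  pos-% : ∀ {n} (b : Fin n) {i} → i < m → pos b i % m ≡ i
  pos-% Fin.zero    i<m = m<n⇒m%n≡m i<m
  pos-% (Fin.suc b) {i} i<m = trans (cong (_% m) (+-comm m (pos b i))) (trans ([m+n]%n≡m%n (pos b i) m) (pos-% b i<m))

  decompose-U : ∀ {k} → k < length U → Σ Block λ b → Σ ℕ λ i → i < m × pos b i ≡ k
  decompose-U {k} k<N = decompose k (subst (k <_) (trans length-U (cong (λ n → m + (m + (m + n))) (sym (+-identityʳ m)))) k<N)

  U-windowMap : WindowMap π (length U) m u s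
  U-windowMap = record
    { ψ        = _% m
    ; ψ-<      = λ {k} _ → m%n<n k m
    ; π-at     = π-at
    ; π-at-suc = π-at-suc
    }
    where
    π-at : ∀ {k} → k < length U → π (u k) ≡ s (k % m)
    π-at k<N with decompose-U k<N
    ... | b , i , i<m , refl = trans (π-u b i<m) (cong s (sym (pos-% b i<m)))
    π-at-suc : ∀ {k} → k < length U → π (u (suc k)) ≡ s (suc (k % m))
    π-at-suc k<N with decompose-U k<N
    ... | b , i , i<m , refl = trans (π-u-suc b i<m) (cong (s ∘ suc) (sym (pos-% b i<m)))

  fibres-separated : FibresSeparated U-windowMap
  fibres-separated k<N l<N k≡l e₀ e₁ with decompose-U k<N | decompose-U l<N
  ... | b , i , i<m , refl | b′ , i′ , i′<m , refl with trans (sym (pos-% b i<m)) (trans k≡l (pos-% b′ i′<m))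
  ... | refl = cong (λ b → pos b i) (blocks-separated b b′ i<m e₀ e₁)

  U-SOSWindows : SOSWindows neg (length U) u
  U-SOSWindows = SOSWindows-pullback U-windowMap {neg} {id} π-neg fibres-separated S-windows

  ∣weight-U : q′ ∣ weight U
  ∣weight-U = subst (q′ ∣_) (sym weight-U) (∣m∣n⇒∣m+n (∣weight-neg S′) (∣weight-neg T))
    where
    weight-U : weight U ≡ (weight S′ + weight (map neg S′)) + (weight T + weight (map neg T))
    weight-U = begin
      weight (S′ ++ map neg S′ ++ T ++ map neg T)
        ≡⟨ weight-++ S′ _ ⟩
      weight S′ + weight (map neg S′ ++ T ++ map neg T)
        ≡⟨ cong (weight S′ +_) (weight-++ (map neg S′) _) ⟩
      weight S′ + (weight (map neg S′) + weight (T ++ map neg T))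
        ≡⟨ cong (λ n → weight S′ + (weight (map neg S′) + n)) (weight-++ T _) ⟩
      weight S′ + (weight (map neg S′) + (weight T + weight (map neg T)))
        ≡⟨ +-assoc (weight S′) _ _ ⟨
      (weight S′ + weight (map neg S′)) + (weight T + weight (map neg T))
        ∎
      where open ≡-Reasoning

q′-cases⇒2q<q′ : ∀ {q q′} → q′ ≡ 2 * q + 1 ⊎ q′ ≡ 2 * q + 2 → q + q < q′
q′-cases⇒2q<q′ {q} (inj₁ refl) = ≤-reflexive (odd q)
  where
  odd : ∀ q → suc (q + q) ≡ 2 * q + 1
  odd = solve-∀
q′-cases⇒2q<q′ {q} (inj₂ refl) = subst (q + q <_) (even q) (m<n⇒m<1+n (n<1+n (q + q)))
  where
  even : ∀ q → suc (suc (q + q)) ≡ 2 * q + 2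
  even = solve-∀

four-halves : ∀ {n} → 2 ∣ n → n / 2 + (n / 2 + (n / 2 + n / 2)) ≡ 2 * n
four-halves {n} 2∣n = trans (double-double (n / 2)) (cong (2 *_) (m*[n/m]≡n 2∣n))
  where
  double-double : ∀ h → h + (h + (h + h)) ≡ 2 * (2 * h)
  double-double = solve-∀

perU*≡ : ∀ q → perU* q ≡ maxPer q + (maxPer q + (maxPer q + maxPer q)) ∸ 3
perU*≡ q with q % 2 in q%2
... | zero  = cong (_∸ 3) (trans (*-assoc 2 q (q ∸ 2)) (sym (four-halves (∣m⇒∣m*n (q ∸ 2) (m%n≡0⇒n∣m q 2 q%2)))))
... | suc k = cong (_∸ 3) (trans (*-assoc 2 q (q ∸ 1)) (sym (four-halves (∣n⇒∣m*n q (divides (q / 2) q∸1≡)))))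
  where
  q∸1≡ : q ∸ 1 ≡ q / 2 * 2
  q∸1≡ = cong (_∸ 1) (trans (m≡m%n+[m/n]*n q 2) (cong (λ r → r + q / 2 * 2) (trans q%2 (cong suc k≡0))))
    where
    k≡0 : k ≡ 0
    k≡0 = n<1⇒n≡0 (≤-pred (subst (_< 2) q%2 (m%n<n q 2)))

%-complement : ∀ {n} .{{_ : NonZero n}} {w σ t} → n ∣ w + σ → σ + t ≡ n → 0 < σ → w % n ≡ t
%-complement {n} {w} {σ} {t} n∣w+σ σ+t≡n 0<σ = begin
  w % n              ≡⟨ [m+n]%n≡m%n w n ⟨
  (w + n) % n        ≡⟨ cong (λ k → (w + k) % n) σ+t≡n ⟨
  (w + (σ + t)) % n  ≡⟨ cong (_% n) (+-assoc w σ t) ⟨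
  (w + σ + t) % n    ≡⟨ %-remove-+ˡ t n∣w+σ ⟩
  t % n              ≡⟨ m<n⇒m%n≡m t<n ⟩
  t                  ∎
  where
  open ≡-Reasoning
  t<n : t < n
  t<n = subst (t <_) (trans (+-comm t σ) σ+t≡n) (m<m+n t 0<σ)

coprime-2-odd : ∀ k → Coprime 2 (2 * k + 1)
coprime-2-odd k = Coprimality.sym (subst (λ n → Coprime n 2) (odd≡ k) (coprime-odd-2 k))
  where
  coprime-odd-2 : ∀ k → Coprime (1 + k * 2) 2
  coprime-odd-2 zero    = 1-coprimeTo 2
  coprime-odd-2 (suc k) = coprime-+ (coprime-odd-2 k)
  odd≡ : ∀ k → 1 + k * 2 ≡ 2 * k + 1
  odd≡ = solve-∀

Choice-complement : ∀ {q q′} {x y z : Fin q} → Choice q q′ x y z →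
  Σ ℕ λ t → toℕ x + toℕ y + toℕ z + t ≡ q′ × 0 < toℕ x + toℕ y + toℕ z × Coprime t q′
Choice-complement {suc (suc k)} (inj₁ (refl , _ , x≡ , y≡ , z≡)) rewrite x≡ | y≡ | z≡ =
  2 , sum≡ k , z<s , coprime-2-odd (suc (suc k))
  where
  sum≡ : ∀ k → 2 + k + suc k + 2 ≡ 2 * suc (suc k) + 1
  sum≡ = solve-∀
Choice-complement {suc (suc k)} (inj₂ (inj₁ (refl , _ , x≡ , y≡ , z≡))) rewrite x≡ | y≡ | z≡ =
  1 , sum≡ k , z<s , 1-coprimeTo _
  where
  sum≡ : ∀ k → 4 + k + suc k + 1 ≡ 2 * suc (suc k) + 2
  sum≡ = solve-∀
Choice-complement {1} (inj₁ (_ , s≤s () , _))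
Choice-complement {1} (inj₂ (inj₁ (_ , s≤s () , _)))
Choice-complement (inj₂ (inj₂ (inj₁ (refl , refl , x≡ , y≡ , z≡)))) rewrite x≡ | y≡ | z≡ =
  7 , refl , z<s , from-yes (coprime? 7 12)
Choice-complement (inj₂ (inj₂ (inj₂ (refl , refl , x≡ , y≡ , z≡)))) rewrite x≡ | y≡ | z≡ =
  11 , refl , z<s , from-yes (coprime? 11 14)

module CycleDeleted (q q′ : ℕ) .{{_ : NonZero q}} .{{_ : NonZero q′}} (2q<q′ : q + q < q′)
                    (x y z : Fin q) (p r : List (Fin q)) (a : Fin q) (as : List (Fin q))
                    (S≡ : a ∷ as ≡ p ++ x ∷ y ∷ z ∷ x ∷ r) (a≡0 : toℕ a ≡ 0) (p≢x : All (_≢ x) p)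
                    (S-OS : IsOS 2 (a ∷ as)) where
  open Folding q q′ 2q<q′
  open Construction q q′ 2q<q′ a as a≡0 (IsOS⇒SOSWindows a as S-OS) public

  x′ y′ z′ : Fin q′
  x′ = red x
  y′ = red y
  z′ = red z

  P R U* : List (Fin q′)
  P  = map red p
  R  = map red r ++ map neg S′ ++ T ++ map neg T
  U* = P ++ x′ ∷ R

  open DeleteCycle d x′ y′ z′ R

  U≡ : U ≡ P ++ x′ ∷ y′ ∷ z′ ∷ x′ ∷ R
  U≡ = begin
    map red (a ∷ as) ++ rest                              ≡⟨ cong (λ L → map red L ++ rest) S≡ ⟩
    map red (p ++ x ∷ y ∷ z ∷ x ∷ r) ++ rest              ≡⟨ cong (_++ rest) (map-++ red p _) ⟩
    (P ++ x′ ∷ y′ ∷ z′ ∷ x′ ∷ map red r) ++ rest          ≡⟨ ++-assoc P _ rest ⟩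
    P ++ x′ ∷ y′ ∷ z′ ∷ x′ ∷ R                            ∎
    where
    open ≡-Reasoning
    rest = map neg S′ ++ T ++ map neg T

  delAfter≡ : delAfter x′ U ≡ U*
  delAfter≡ = trans (cong (delAfter x′) U≡)
                    (delAfter-deleteCycle x′ y′ z′ R P (All.map⁺ (All.map (λ c≢x → c≢x ∘ red-injective) p≢x)))

  U*-IsSOS : IsSOS 2 U*
  U*-IsSOS = SOSWindows⇒IsSOS d U* 0<length (trans (index-head P) (cong (λ L → index d L 0) (sym U≡)))
               (SOSWindows-deleteCycle {neg} P (subst (λ L → SOSWindows neg (length L) (index d L)) U≡ U-SOSWindows))
    where
    0<length : 0 < length U*
    0<length = subst (0 <_) (sym (length-++ P)) (≤-trans (s≤s z≤n) (m≤n+m _ (length P)))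

  length-U* : length U ≡ 3 + length U*
  length-U* = trans (cong length U≡) (length-deleteCycle P)

  ∣weight-U* : q′ ∣ weight U* + (toℕ x + toℕ y + toℕ z)
  ∣weight-U* = subst (q′ ∣_) (trans (cong weight U≡) weight≡) ∣weight-U
    where
    weight≡ : weight (P ++ x′ ∷ y′ ∷ z′ ∷ x′ ∷ R) ≡ weight U* + (toℕ x + toℕ y + toℕ z)
    weight≡ = trans (weight-deleteCycle x′ y′ z′ R P)
                    (cong (weight U* +_) (cong₂ _+_ (cong₂ _+_ (toℕ-red x) (toℕ-red y)) (toℕ-red z)))

theorem3p23-normalForm : ∀ q q′ .{{_ : NonZero q′}} → 4 < q → (q′ ≡ 2 * q + 1 ⊎ q′ ≡ 2 * q + 2) →
  (x y z : Fin q) → Choice q q′ x y z → ∀ p r {a as} → a ∷ as ≡ p ++ x ∷ y ∷ z ∷ x ∷ r → toℕ a ≡ 0 →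
  All (_≢ x) p → IsOS 2 (a ∷ as) → length (a ∷ as) ≡ maxPer q →
    IsSOS 2 (delAfter (red x) (Useq q q′ (a ∷ as)))
    × length (delAfter (red x) (Useq q q′ (a ∷ as))) ≡ perU* q
    × Coprime (weight (delAfter (red x) (Useq q q′ (a ∷ as))) % q′) q′
theorem3p23-normalForm q q′ 4<q q′-cases x y z choice p r S≡ a≡0 p≢x S-OS |S|≡maxPer with Choice-complement choice
... | t , σ+t≡q′ , 0<σ , t-coprime =
  subst (IsSOS 2) (sym delAfter≡) U*-IsSOS ,
  trans (cong length delAfter≡) length≡ ,
  subst (λ L → Coprime (weight L % q′) q′) (sym delAfter≡)
        (subst (λ w → Coprime w q′) (sym (%-complement ∣weight-U* σ+t≡q′ 0<σ)) t-coprime)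
  where
  instance
    q≢0 : NonZero q
    q≢0 = >-nonZero (<-trans z<s 4<q)
  open CycleDeleted q q′ (q′-cases⇒2q<q′ {q} q′-cases) x y z p r _ _ S≡ a≡0 p≢x S-OS
  length≡ : length U* ≡ perU* q
  length≡ = begin
    length U*                                                ≡⟨ m+n∸m≡n 3 _ ⟨
    3 + length U* ∸ 3                                        ≡⟨ cong (_∸ 3) length-U* ⟨
    length U ∸ 3                                             ≡⟨ cong (_∸ 3) length-U ⟩
    m + (m + (m + m)) ∸ 3                                    ≡⟨ cong (λ n → n + (n + (n + n)) ∸ 3) |S|≡maxPer ⟩
    maxPer q + (maxPer q + (maxPer q + maxPer q)) ∸ 3        ≡⟨ perU*≡ q ⟨
    perU* q                                                  ∎
    where open ≡-Reasoning

theorem3p23 : (q q' : ℕ) → .{{_ : NonZero q'}} → 4 < q → (q' ≡ 2 * q + 1 ⊎ q' ≡ 2 * q + 2)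
    → (x y z : Fin q) → Choice q q' x y z
    → (S : List (Fin q)) → IsOS 2 S → length S ≡ maxPer q → HasForm x y z S
    → IsSOS 2 (delAfter (red x) (Useq q q' S))
      × length (delAfter (red x) (Useq q q' S)) ≡ perU* q
      × Coprime (weight (delAfter (red x) (Useq q q' S)) % q') q'
theorem3p23 q q′ 4<q q′-cases x y z choice S S-OS |S|≡maxPer (zero-form , nonzero-form) with toℕ x ℕ.≟ 0
... | yes x≡0 with zero-form x≡0
...   | r , refl = theorem3p23-normalForm q q′ 4<q q′-cases x y z choice [] r refl x≡0 [] S-OS |S|≡maxPer
theorem3p23 q q′ 4<q q′-cases x y z choice S S-OS |S|≡maxPer (zero-form , nonzero-form) | no x≢0
  with nonzero-form x≢0
...   | a , r , a≡0 , refl = theorem3p23-normalForm q q′ 4<q q′-cases x y z choice (a ∷ []) r refl a≡0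
                               ((λ a≡x → x≢0 (subst (λ c → toℕ c ≡ 0) a≡x a≡0)) ∷ []) S-OS |S|≡maxPer
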